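{- A nonnegative integer $n$ is realizable by the Mostar index, i.e., there exists a finite simple connected graph $G$ with $Mo(G)=n$, if and only if $n\neq 1$.
   Context: All graphs are finite, simple and connected. For a graph $G$ and an edge $uv\in E(G)$, let $n_u$ be the number of vertices of $G$ strictly closer (in shortest-path distance) to $u$ than to $v$, and $n_v$ analogously. The Mostar index of $G$ is $Mo(G)=\sum_{uv\in E(G)}|n_u-n_v|$. -}

module Defs where

open import Data.Nat using (ℕ; zero; suc; _+_; _<ᵇ_; _≤_; ∣_-_∣)
open import Data.Bool using (Bool; true; false; _∧_; _∨_; if_then_else_)
open import Data.Fin using (Fin; toℕ; _≟_)
open import Data.List using (List; []; _∷_; map; filter; length; allFin)
open import Data.Nat.ListAction using (sum)
open import Data.Bool.ListAction using (any)
open import Relation.Nullary.Decidable using (⌊_⌋)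
open import Relation.Binary.PropositionalEquality using (_≡_)

record SimpleGraph : Set where
  field
    n      : ℕ
    adj    : Fin n → Fin n → Bool
    sym    : ∀ u v → adj u v ≡ adj v u
    irrefl : ∀ u → adj u u ≡ false

data Walk (G : SimpleGraph) : Fin (SimpleGraph.n G) → Fin (SimpleGraph.n G) → Set where
  nil  : ∀ {u} → Walk G u u
  cons : ∀ {u v w} → SimpleGraph.adj G u v ≡ true → Walk G v w → Walk G u w

record Connected (G : SimpleGraph) : Set where
  field
    nonempty : 1 ≤ SimpleGraph.n G
    walk     : ∀ u v → Walk G u v

module _ (G : SimpleGraph) where
  open SimpleGraph G

  vertices : List (Fin n)
  vertices = allFin n

  within : ℕ → Fin n → Fin n → Bool
  within zero    u v = ⌊ u ≟ v ⌋
  within (suc k) u v = within k u v ∨ any (λ w → within k u w ∧ adj w v) vertices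

  search : ℕ → ℕ → Fin n → Fin n → ℕ
  search k zero     u v = k
  search k (suc f) u v = if within k u v then k else search (suc k) f u v

  -- shortest-path distance d(u,v): the least k with a walk of length k
  -- (in a connected graph on n vertices it is < n, so fuel n suffices)
  dist : Fin n → Fin n → ℕ
  dist u v = search 0 n u v

  closer : Fin n → Fin n → ℕ
  closer u v = length (filter (λ w → dist w u Data.Nat.<? dist w v) vertices)

  -- Mostar index: sum over edges {u,v} (each counted once, toℕ u < toℕ v)
  edgeTerm : Fin n → Fin n → ℕ
  edgeTerm u v = if adj u v ∧ (toℕ u <ᵇ toℕ v) then ∣ closer u v - closer v u ∣ else 0

  Mo : ℕ
  Mo = sum (map (λ u → sum (map (λ v → edgeTerm u v) vertices)) vertices)

-- For an edge uv of a connected graph, d(w,u) and d(w,v) differ by at most one for every w, so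
-- σ(u) + n_u = σ(v) + n_v, where σ(x) = Σ_w d(w,x) is the transmission; hence the Mostar index
-- measures how much σ jumps along edges. If Mo(G) = 1, then exactly one edge ab has |n_a − n_b| = 1
-- and all other edges join vertices of equal transmission. Following shortest paths, σ is then
-- σ(a) on the vertices closer to a and σ(b) on those closer to b, no vertex is equidistant from a
-- and b, and ab is the only edge between the two sides. Say n_a = n_b + 1 and take x ≠ a closer to
-- a, with D = d(a,x) ≥ 1. Every vertex on b's side reaches x through a, so summing distances gives
-- σ(x) ≥ σ(a) − D·n_a + D·n_b + 2D = σ(a) + D > σ(a) = σ(x), a contradiction.
--
-- Conversely, 0, 3, 5, 7 and 9 are realised by explicit small graphs, and every other value
-- m ≠ 1 has the form 2q + 2, 4q + 11, 8q + 13 or 8q + 17 (according to m mod 8). These are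
-- realised by joining a clique K_{q+1} to a fixed set of vertices of a fixed base graph: the
-- distances in such a blow-up do not depend on q, so they are certified once by a finite check,
-- and the Mostar index comes out as an affine function of q.
module Submission where

open import Defs
open import Data.Nat using (ℕ)
open import Data.Product using (Σ; _×_)
open import Relation.Binary.PropositionalEquality using (_≡_; _≢_)
open import Function.Bundles using (_⇔_)

open import Data.Bool using (Bool; true; false; T; not; _∧_; _∨_; if_then_else_)
open import Data.Bool.ListAction using (any)
open import Data.Bool.Properties using (T-∨; T-∧; T-≡; T?; ∧-zeroʳ; ∨-comm) renaming (_≟_ to _≟ᵇ_)
open import Data.Empty using (⊥; ⊥-elim)
open import Data.Fin using (Fin; toℕ; _↑ˡ_; _↑ʳ_; splitAt; join)
  renaming (_≟_ to _≟ᶠ_; zero to fzero; suc to fsuc)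
open import Data.Fin.Properties
  using (all?; any?; toℕ-injective; toℕ<n; toℕ-↑ˡ; toℕ-↑ʳ; splitAt-↑ˡ; splitAt-↑ʳ; splitAt-join; join-splitAt)
  renaming (suc-injective to fsuc-injective)
open import Data.List using (List; []; _∷_; map; filter; length; allFin; tabulate)
open import Data.List.Membership.Propositional using (lose)
open import Data.List.Membership.Propositional.Properties using (∈-allFin)
open import Data.List.Relation.Unary.Any using (satisfied)
open import Data.List.Relation.Unary.Any.Properties using (any⁺; any⁻)
open import Data.Nat using (zero; suc; pred; NonZero; _+_; _*_; _∸_; _≤_; _<_; z≤n; s≤s; z<s;
  _≟_; _≤?_; _<?_; _≡ᵇ_; _<ᵇ_; ∣_-_∣; >-nonZero)
open import Data.Nat.DivMod using (_%_; _/_; m≡m%n+[m/n]*n; m%n<n)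
open import Data.Nat.ListAction using (sum)
open import Data.Nat.Properties
open import Data.Nat.Tactic.RingSolver using (solve-∀)
open import Data.Product using (_,_; ∃; proj₁; proj₂)
open import Data.Sum using (_⊎_; inj₁; inj₂; [_,_]′)
open import Data.Vec using (Vec; lookup; []; _∷_)
open import Function using (id; _∘_)
open import Function.Bundles using (Equivalence; mk⇔)
open import Level using (Level)
open import Relation.Binary using (tri<; tri≈; tri>)
open import Relation.Binary.PropositionalEquality using (refl; sym; trans; cong; cong₂; subst; subst₂; module ≡-Reasoning)
open import Relation.Nullary using (¬_; Dec; does; yes; no)
open import Relation.Nullary.Decidable
  using (True; toWitness; fromWitness; from-yes; dec-true; dec-false; does-⇔; map′; _×-dec_; _⊎-dec_; _→-dec_)
open import Relation.Unary using (Pred; Decidable)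

open import Algebra.Properties.Semiring.Sum +-*-semiring
  using (sum-syntax; sum-cong-≗; ∑-distrib-+; *-distribˡ-sum; sum-replicate-zero)
  renaming (sum to ∑)

𝟙 : Bool → ℕ
𝟙 true  = 1
𝟙 false = 0

𝟙≤1 : ∀ b → 𝟙 b ≤ 1
𝟙≤1 true  = ≤-refl
𝟙≤1 false = z≤n

count : ∀ {n ℓ} {P : Pred (Fin n) ℓ} → Decidable P → ℕ
count {n} P? = ∑[ i < n ] 𝟙 (does (P? i))

∑-mono-≤ : ∀ {n} {f g : Fin n → ℕ} → (∀ i → f i ≤ g i) → ∑ f ≤ ∑ g
∑-mono-≤ {zero}  f≤g = z≤n
∑-mono-≤ {suc n} f≤g = +-mono-≤ (f≤g fzero) (∑-mono-≤ (λ i → f≤g (fsuc i)))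

∑-mono-< : ∀ {n} {f g : Fin n → ℕ} → (∀ i → f i ≤ g i) → ∀ y → f y < g y → ∑ f < ∑ g
∑-mono-< {suc n} f≤g fzero    fy<gy = +-mono-<-≤ fy<gy (∑-mono-≤ (λ i → f≤g (fsuc i)))
∑-mono-< {suc n} f≤g (fsuc y) fy<gy = +-mono-≤-< (f≤g fzero) (∑-mono-< (λ i → f≤g (fsuc i)) y fy<gy)

term≤∑ : ∀ {n} (f : Fin n → ℕ) y → f y ≤ ∑ f
term≤∑ f fzero    = m≤m+n _ _
term≤∑ f (fsuc y) = ≤-trans (term≤∑ (λ i → f (fsuc i)) y) (m≤n+m _ _)

∑≡0⇒≡0 : ∀ {n} (f : Fin n → ℕ) → ∑ f ≡ 0 → ∀ x → f x ≡ 0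
∑≡0⇒≡0 f ∑f≡0 x = n≤0⇒n≡0 (subst (f x ≤_) ∑f≡0 (term≤∑ f x))

∑≡1⇒unique : ∀ {n} (f : Fin n → ℕ) → ∑ f ≡ 1 →
             Σ (Fin n) λ a → f a ≡ 1 × (∀ x → x ≢ a → f x ≡ 0)
∑≡1⇒unique {suc n} f ∑f≡1 with f fzero in f0
... | 0 with ∑≡1⇒unique (λ i → f (fsuc i)) ∑f≡1
...   | a , fa≡1 , rest = fsuc a , fa≡1 , others
  where
  others : ∀ x → x ≢ fsuc a → f x ≡ 0
  others fzero    _ = f0
  others (fsuc x) x≢a = rest x (λ x≡a → x≢a (cong fsuc x≡a))
∑≡1⇒unique {suc n} f ∑f≡1 | 1 = fzero , f0 , others
  where
  others : ∀ x → x ≢ fzero → f x ≡ 0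
  others fzero    x≢0 = ⊥-elim (x≢0 refl)
  others (fsuc x) _   = ∑≡0⇒≡0 (λ i → f (fsuc i)) (suc-injective ∑f≡1) x

∑∑≡1⇒unique : ∀ {m n} (f : Fin m → Fin n → ℕ) → ∑[ i < m ] ∑[ j < n ] f i j ≡ 1 →
               Σ (Fin m) λ a → Σ (Fin n) λ b → f a b ≡ 1 × (∀ x y → x ≢ a ⊎ y ≢ b → f x y ≡ 0)
∑∑≡1⇒unique {n = n} f ∑∑≡1 with ∑≡1⇒unique (λ i → ∑[ j < n ] f i j) ∑∑≡1
... | a , row-a≡1 , other-rows with ∑≡1⇒unique (f a) row-a≡1
...   | b , fab≡1 , other-columns = a , b , fab≡1 , vanishes
  where
  vanishes : ∀ x y → x ≢ a ⊎ y ≢ b → f x y ≡ 0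
  vanishes x y x≢a⊎y≢b with x ≟ᶠ a | x≢a⊎y≢b
  ... | no x≢a   | _        = ∑≡0⇒≡0 (f x) (other-rows x x≢a) y
  ... | yes refl | inj₂ y≢b = other-columns y y≢b
  ... | yes refl | inj₁ a≢a = ⊥-elim (a≢a refl)

∑-const : ∀ n c → ∑[ i < n ] c ≡ n * c
∑-const zero    c = refl
∑-const (suc n) c = cong (c +_) (∑-const n c)

∑-splitAt : ∀ m n (f : Fin (m + n) → ℕ) → ∑ f ≡ ∑[ i < m ] f (i ↑ˡ n) + ∑[ j < n ] f (m ↑ʳ j)
∑-splitAt zero    n f = refl
∑-splitAt (suc m) n f = trans (cong (f fzero +_) (∑-splitAt m n (λ i → f (fsuc i))))
                              (sym (+-assoc (f fzero) _ _))

∑-distrib-+-*ˡ : ∀ {n} (f g : Fin n → ℕ) c → ∑[ i < n ] (f i + c * g i) ≡ ∑ f + c * ∑ g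
∑-distrib-+-*ˡ f g c = trans (∑-distrib-+ f (λ i → c * g i)) (cong (∑ f +_) (sym (*-distribˡ-sum c g)))

∑-𝟙-const : ∀ n b → ∑[ i < n ] 𝟙 b ≡ (if b then n else 0)
∑-𝟙-const n true  = trans (∑-const n 1) (*-identityʳ n)
∑-𝟙-const n false = sum-replicate-zero n

module _ {ℓ : Level} where

  1≤count : ∀ {n} {P : Pred (Fin n) ℓ} (P? : Decidable P) x → P x → 1 ≤ count P?
  1≤count P? x Px = ≤-trans (≤-reflexive (cong 𝟙 (sym (dec-true (P? x) Px)))) (term≤∑ (λ i → 𝟙 (does (P? i))) x)

  count-≥n⇒all : ∀ {n} {P : Pred (Fin n) ℓ} (P? : Decidable P) → n ≤ count P? → ∀ x → P x
  count-≥n⇒all {n} P? n≤count x with P? x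
  ... | yes Px = Px
  ... | no ¬Px = ⊥-elim (<⇒≱ count<n n≤count)
    where
    count<n : count P? < n
    count<n = subst (count P? <_) (trans (∑-const n 1) (*-identityʳ n))
                    (∑-mono-< (λ i → 𝟙≤1 (does (P? i))) x
                              (subst (λ b → 𝟙 b < 1) (sym (dec-false (P? x) ¬Px)) ≤-refl))

  count-pos⇒∃ : ∀ {n} {P : Pred (Fin n) ℓ} (P? : Decidable P) → 1 ≤ count P? → ∃ P
  count-pos⇒∃ {suc n} P? 1≤count with P? fzero
  ... | yes P0 = fzero , P0
  ... | no  _  with count-pos⇒∃ (λ i → P? (fsuc i)) 1≤count
  ...   | x , Px = fsuc x , Px

  count-≥2⇒∃≢ : ∀ {n} {P : Pred (Fin n) ℓ} (P? : Decidable P) → 2 ≤ count P? →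
                ∀ a → Σ (Fin n) λ x → P x × x ≢ a
  count-≥2⇒∃≢ {suc n} P? 2≤count fzero with count-pos⇒∃ (λ i → P? (fsuc i))
      (≤-pred (≤-trans 2≤count (+-monoˡ-≤ _ (𝟙≤1 (does (P? fzero))))))
  ... | x , Px = fsuc x , Px , λ ()
  count-≥2⇒∃≢ {suc n} P? 2≤count (fsuc a) with P? fzero
  ... | yes P0 = fzero , P0 , λ ()
  ... | no  _  with count-≥2⇒∃≢ (λ i → P? (fsuc i)) 2≤count a
  ...   | x , Px , x≢a = fsuc x , Px , λ x≡a → x≢a (fsuc-injective x≡a)

  count-mono-< : ∀ {n} {P Q : Pred (Fin n) ℓ} (P? : Decidable P) (Q? : Decidable Q) →
                 (∀ x → P x → Q x) → ∀ y → ¬ P y → Q y → count P? < count Q?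
  count-mono-< P? Q? P⊆Q y ¬Py Qy = ∑-mono-< 𝟙-mono y 𝟙-jumps
    where
    𝟙-mono : ∀ x → 𝟙 (does (P? x)) ≤ 𝟙 (does (Q? x))
    𝟙-mono x with P? x | Q? x
    ... | yes Px | no ¬Qx = ⊥-elim (¬Qx (P⊆Q x Px))
    ... | yes _  | yes _  = ≤-refl
    ... | no _   | _      = z≤n
    𝟙-jumps : 𝟙 (does (P? y)) < 𝟙 (does (Q? y))
    𝟙-jumps rewrite dec-false (P? y) ¬Py | dec-true (Q? y) Qy = ≤-refl

count-≟ : ∀ {n} (a : Fin n) → count (_≟ᶠ a) ≡ 1
count-≟ {suc n} fzero    = cong suc (sum-replicate-zero n)
count-≟ {suc n} (fsuc a) = count-≟ a

sum-map-tabulate : ∀ {A : Set} {n} (g : Fin n → A) (f : A → ℕ) →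
                   sum (map f (tabulate g)) ≡ ∑[ i < n ] f (g i)
sum-map-tabulate {n = zero}  g f = refl
sum-map-tabulate {n = suc n} g f = cong (f (g fzero) +_) (sum-map-tabulate (λ i → g (fsuc i)) f)

length-filter-tabulate : ∀ {A : Set} {n ℓ} {P : Pred A ℓ} (P? : Decidable P) (g : Fin n → A) →
                         length (filter P? (tabulate g)) ≡ count (λ i → P? (g i))
length-filter-tabulate {n = zero}  P? g = refl
length-filter-tabulate {n = suc n} P? g with does (P? (g fzero))
... | true  = cong suc (length-filter-tabulate P? (λ i → g (fsuc i)))
... | false = length-filter-tabulate P? (λ i → g (fsuc i))

m+[m<n]≡n+[n<m] : ∀ m n → m ≤ suc n → n ≤ suc m → m + 𝟙 (does (m <? n)) ≡ n + 𝟙 (does (n <? m))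
m+[m<n]≡n+[n<m] m n m≤1+n n≤1+m with <-cmp m n
... | tri≈ _ refl _ = refl
... | tri< m<n _ _ rewrite dec-true (m <? n) m<n | dec-false (n <? m) (<⇒≯ m<n)
                         | ≤-antisym n≤1+m m<n = trans (+-comm m 1) (sym (+-identityʳ (suc m)))
... | tri> _ _ n<m rewrite dec-false (m <? n) (<⇒≯ n<m) | dec-true (n <? m) n<m
                         | ≤-antisym m≤1+n n<m = trans (+-identityʳ (suc n)) (+-comm 1 n)

∣m-n∣≡1⇒m≡1+n⊎n≡1+m : ∀ m n → ∣ m - n ∣ ≡ 1 → m ≡ suc n ⊎ n ≡ suc m
∣m-n∣≡1⇒m≡1+n⊎n≡1+m zero    n       ∣m-n∣≡1 = inj₂ ∣m-n∣≡1
∣m-n∣≡1⇒m≡1+n⊎n≡1+m (suc m) zero    ∣m-n∣≡1 = inj₁ (cong suc (suc-injective ∣m-n∣≡1))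
∣m-n∣≡1⇒m≡1+n⊎n≡1+m (suc m) (suc n) ∣m-n∣≡1 with ∣m-n∣≡1⇒m≡1+n⊎n≡1+m m n ∣m-n∣≡1
... | inj₁ m≡1+n = inj₁ (cong suc m≡1+n)
... | inj₂ n≡1+m = inj₂ (cong suc n≡1+m)

module Reachability (G : SimpleGraph) where
  open SimpleGraph G using (n; adj)

  -- A record rather than T (within G k u v), so that k, u and v can be inferred.
  record Within (k : ℕ) (u v : Fin n) : Set where
    constructor within✓
    field holds : T (within G k u v)

  within-refl : ∀ u → Within 0 u u
  within-refl u = within✓ (fromWitness refl)

  within-zero⁻ : ∀ {u v} → Within 0 u v → u ≡ v
  within-zero⁻ (within✓ h) = toWitness h

  within-suc : ∀ {k u v} → Within k u v → Within (suc k) u v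
  within-suc (within✓ h) = within✓ (Equivalence.from T-∨ (inj₁ h))

  within-snoc : ∀ {k u x v} → Within k u x → adj x v ≡ true → Within (suc k) u v
  within-snoc {x = x} (within✓ h) xv = within✓ (Equivalence.from T-∨ (inj₂
    (any⁺ _ (lose (∈-allFin x) (Equivalence.from T-∧ (h , Equivalence.from T-≡ xv))))))

  within-suc⁻ : ∀ {k u v} → Within (suc k) u v →
                Within k u v ⊎ Σ (Fin n) λ x → Within k u x × adj x v ≡ true
  within-suc⁻ (within✓ h) with Equivalence.to T-∨ h
  ... | inj₁ h′ = inj₁ (within✓ h′)
  ... | inj₂ h′ with satisfied (any⁻ _ (allFin n) h′)
  ...   | x , hx with Equivalence.to T-∧ hx
  ...     | ux , xv = inj₂ (x , within✓ ux , Equivalence.to T-≡ xv)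

  within-≤ : ∀ {k j u v} → k ≤ j → Within k u v → Within j u v
  within-≤ {j = zero}  z≤n w = w
  within-≤ {j = suc j} k≤j w with m≤n⇒m<n∨m≡n k≤j
  ... | inj₂ refl       = w
  ... | inj₁ (s≤s k≤j′) = within-suc (within-≤ k≤j′ w)

  within-cons : ∀ {k u y v} → adj u y ≡ true → Within k y v → Within (suc k) u v
  within-cons {zero} {u} uy w with within-zero⁻ w
  ... | refl = within-snoc (within-refl u) uy
  within-cons {suc k} uy w with within-suc⁻ w
  ... | inj₁ w′            = within-suc (within-cons uy w′)
  ... | inj₂ (x , w′ , xv) = within-snoc (within-cons uy w′) xv

  within-sym : ∀ {k u v} → Within k u v → Within k v u
  within-sym {zero} w with within-zero⁻ w
  ... | refl = w
  within-sym {suc k} w with within-suc⁻ w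
  ... | inj₁ w′            = within-suc (within-sym w′)
  ... | inj₂ (x , w′ , xv) = within-cons (trans (SimpleGraph.sym G _ x) xv) (within-sym w′)

  within-+ : ∀ {i j u y v} → Within i u y → Within j y v → Within (i + j) u v
  within-+ {i} {zero} w₁ w₂ with within-zero⁻ w₂
  ... | refl = subst (λ t → Within t _ _) (sym (+-identityʳ i)) w₁
  within-+ {i} {suc j} w₁ w₂ rewrite +-suc i j with within-suc⁻ w₂
  ... | inj₁ w₂′            = within-suc (within-+ w₁ w₂′)
  ... | inj₂ (x , w₂′ , xv) = within-snoc (within-+ w₁ w₂′) xv

  walk→within : ∀ {u v} → Walk G u v → Σ ℕ λ k → Within k u v
  walk→within {u} nil   = 0 , within-refl u
  walk→within (cons uy w) with walk→within w
  ... | k , w′ = suc k , within-cons uy w′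

  walk-snoc : ∀ {u x v} → Walk G u x → adj x v ≡ true → Walk G u v
  walk-snoc nil        xv = cons xv nil
  walk-snoc (cons e w) xv = cons e (walk-snoc w xv)

  within→walk : ∀ {k u v} → Within k u v → Walk G u v
  within→walk {zero} w with within-zero⁻ w
  ... | refl = nil
  within→walk {suc k} w with within-suc⁻ w
  ... | inj₁ w′            = within→walk w′
  ... | inj₂ (x , w′ , xv) = walk-snoc (within→walk w′) xv

  search-≤ : ∀ {j u v} k fuel → Within j u v → k ≤ j → search G k fuel u v ≤ j
  search-≤ k zero       w k≤j = k≤j
  search-≤ {j} {u} {v} k (suc fuel) w k≤j with within G k u v in found
  ... | true  = k≤j
  ... | false = search-≤ (suc k) fuel w (≤∧≢⇒< k≤j k≢j)
    where
    k≢j : k ≢ j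
    k≢j refl with trans (sym found) (Equivalence.to T-≡ (Within.holds w))
    ... | ()

  search-within : ∀ {j u v} k fuel → Within j u v → j < k + fuel → Within (search G k fuel u v) u v
  search-within {j} k zero w j<k+0 = within-≤ (<⇒≤ (subst (j <_) (+-identityʳ k) j<k+0)) w
  search-within {j} {u} {v} k (suc fuel) w j<k+fuel with within G k u v in found
  ... | true  = within✓ (Equivalence.from T-≡ found)
  ... | false = search-within (suc k) fuel w (subst (j <_) (+-suc k fuel) j<k+fuel)

  dist-≤ : ∀ {j u v} → Within j u v → dist G u v ≤ j
  dist-≤ w = search-≤ 0 n w z≤n

  dist-within : ∀ {j u v} → Within j u v → j < n → Within (dist G u v) u v
  dist-within w j<n = search-within 0 n w j<n

module Metric (G : SimpleGraph) (conn : Connected G) where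
  open SimpleGraph G using (n; adj)
  open Reachability G

  module _ (u : Fin n) where

    ball : ℕ → ℕ
    ball k = count (λ x → T? (within G k u x))

    Closed : ℕ → Set
    Closed k = ∀ x → Within (suc k) u x → Within k u x

    closed-suc : ∀ {k} → Closed k → Closed (suc k)
    closed-suc closed x w with within-suc⁻ w
    ... | inj₁ w′            = w′
    ... | inj₂ (y , w′ , yx) = within-snoc (closed y w′) yx

    closed-absorbs : ∀ {k} → Closed k → ∀ j x → Within (j + k) u x → Within k u x
    closed-absorbs closed zero    x w = w
    closed-absorbs {k} closed (suc j) x w = closed-absorbs closed j x (iterate j x w)
      where
      iterate : ∀ j → Closed (j + k)
      iterate zero    = closed
      iterate (suc j) = closed-suc (iterate j)

    ball-grows-or-closed : ∀ k → suc k ≤ ball k ⊎ Closed k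
    ball-grows-or-closed zero = inj₁ (1≤count (λ x → T? (within G 0 u x)) u (Within.holds (within-refl u)))
    ball-grows-or-closed (suc k) with ball-grows-or-closed k
    ... | inj₂ closed = inj₂ (closed-suc closed)
    ... | inj₁ k<ball with suc (ball k) ≤? ball (suc k)
    ...   | yes grows = inj₁ (≤-trans (s≤s k<ball) grows)
    ...   | no stalls = inj₂ (closed-suc closed)
      where
      closed : Closed k
      closed x (within✓ w) with T? (within G k u x)
      ... | yes wk = within✓ wk
      ... | no ¬wk = ⊥-elim (stalls (count-mono-< (λ y → T? (within G k u y)) (λ y → T? (within G (suc k) u y))
                                       (λ y wy → Within.holds (within-suc {k} {u} {y} (within✓ wy))) x ¬wk w))

  private instance
    n-nonZero : NonZero n
    n-nonZero = >-nonZero (Connected.nonempty conn)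

  radius<n : pred n < n
  radius<n = subst (pred n <_) (suc-pred n) ≤-refl

  -- Pigeonhole on the sizes of the balls around u.
  within-radius : ∀ u v → Within (pred n) u v
  within-radius u v with ball-grows-or-closed u (pred n) | walk→within (Connected.walk conn u v)
  ... | inj₁ full   | _ = within✓ (count-≥n⇒all (λ x → T? (within G (pred n) u x))
                                                (subst (_≤ ball u (pred n)) (suc-pred n) full) v)
  ... | inj₂ closed | L , w with L ≤? pred n
  ...   | yes L≤r = within-≤ L≤r w
  ...   | no  L≰r = closed-absorbs u closed (L ∸ pred n) v
                      (subst (λ t → Within t u v) (sym (m∸n+n≡m (<⇒≤ (≰⇒> L≰r)))) w)

  dist-shortest : ∀ u v → Within (dist G u v) u v
  dist-shortest u v = dist-within (within-radius u v) radius<n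

  dist-self : ∀ u → dist G u u ≡ 0
  dist-self u = n≤0⇒n≡0 (dist-≤ (within-refl u))

  dist≡0⇒≡ : ∀ {u v} → dist G u v ≡ 0 → u ≡ v
  dist≡0⇒≡ {u} {v} d≡0 = within-zero⁻ (subst (λ t → Within t u v) d≡0 (dist-shortest u v))

  dist-sym : ∀ u v → dist G u v ≡ dist G v u
  dist-sym u v = ≤-antisym (dist-≤ (within-sym (dist-shortest v u))) (dist-≤ (within-sym (dist-shortest u v)))

  dist-triangle : ∀ u y v → dist G u v ≤ dist G u y + dist G y v
  dist-triangle u y v = dist-≤ (within-+ (dist-shortest u y) (dist-shortest y v))

  dist-adj : ∀ {u v} w → adj u v ≡ true → dist G w v ≤ suc (dist G w u)
  dist-adj w uv = dist-≤ (within-snoc (dist-shortest w _) uv)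

  dist-pred : ∀ {w v m} → dist G w v ≡ suc m → Σ (Fin n) λ u → adj u v ≡ true × dist G w u ≡ m
  dist-pred {w} {v} {m} d≡1+m with within-suc⁻ (subst (λ t → Within t w v) d≡1+m (dist-shortest w v))
  ... | inj₁ shorter = ⊥-elim (<-irrefl d≡1+m (s≤s (dist-≤ shorter)))
  ... | inj₂ (u , wu , uv) = u , uv , ≤-antisym (dist-≤ wu) (≤-pred (subst (_≤ suc (dist G w u)) d≡1+m (dist-adj w uv)))

Mo≡∑∑edgeTerm : ∀ G → Mo G ≡ ∑[ u < SimpleGraph.n G ] ∑[ v < SimpleGraph.n G ] edgeTerm G u v
Mo≡∑∑edgeTerm G = trans (sum-map-tabulate id row) (sum-cong-≗ λ u → sum-map-tabulate id (edgeTerm G u))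
  where
  row : Fin (SimpleGraph.n G) → ℕ
  row u = sum (map (edgeTerm G u) (allFin (SimpleGraph.n G)))

module EdgeTerm (G : SimpleGraph) where
  open SimpleGraph G using (n; adj)

  adj-sym : ∀ {u v} → adj u v ≡ true → adj v u ≡ true
  adj-sym {u} {v} uv = trans (SimpleGraph.sym G v u) uv

  adj⇒≢ : ∀ {u v} → adj u v ≡ true → u ≢ v
  adj⇒≢ {u} uv refl with trans (sym uv) (SimpleGraph.irrefl G u)
  ... | ()

  edgeTerm≢0⇒adj : ∀ {u v} → edgeTerm G u v ≢ 0 → adj u v ≡ true
  edgeTerm≢0⇒adj {u} {v} term≢0 with adj u v
  ... | true  = refl
  ... | false = ⊥-elim (term≢0 refl)

  edgeTerm-both : ∀ {u v} → adj u v ≡ true →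
                  edgeTerm G u v + edgeTerm G v u ≡ ∣ closer G u v - closer G v u ∣
  edgeTerm-both {u} {v} uv with <-cmp (toℕ u) (toℕ v)
  ... | tri≈ _ u≡v _ = ⊥-elim (adj⇒≢ uv (toℕ-injective u≡v))
  ... | tri< u<v _ _ rewrite uv | adj-sym uv | dec-true (toℕ u <? toℕ v) u<v
                           | dec-false (toℕ v <? toℕ u) (<⇒≯ u<v) = +-identityʳ _
  ... | tri> _ _ v<u rewrite uv | adj-sym uv | dec-false (toℕ u <? toℕ v) (<⇒≯ v<u)
                           | dec-true (toℕ v <? toℕ u) v<u = ∣-∣-comm (closer G v u) (closer G u v)

module Transmission (G : SimpleGraph) (conn : Connected G) where
  open SimpleGraph G using (n; adj)
  open Metric G conn
  open EdgeTerm G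

  d : Fin n → Fin n → ℕ
  d = dist G

  transmission : Fin n → ℕ
  transmission x = ∑[ w < n ] d w x

  closer≡count : ∀ u v → closer G u v ≡ count (λ w → d w u <? d w v)
  closer≡count u v = length-filter-tabulate (λ w → d w u <? d w v) id

  transmission-closer : ∀ {u v} → adj u v ≡ true →
                        transmission u + closer G u v ≡ transmission v + closer G v u
  transmission-closer {u} {v} uv = begin
    transmission u + closer G u v                         ≡⟨ cong (transmission u +_) (closer≡count u v) ⟩
    ∑[ w < n ] d w u + ∑[ w < n ] 𝟙 (does (d w u <? d w v)) ≡⟨ ∑-distrib-+ (λ w → d w u) _ ⟨
    ∑[ w < n ] (d w u + 𝟙 (does (d w u <? d w v)))       ≡⟨ sum-cong-≗ balance ⟩
    ∑[ w < n ] (d w v + 𝟙 (does (d w v <? d w u)))       ≡⟨ ∑-distrib-+ (λ w → d w v) _ ⟩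
    ∑[ w < n ] d w v + ∑[ w < n ] 𝟙 (does (d w v <? d w u)) ≡⟨ cong (transmission v +_) (closer≡count v u) ⟨
    transmission v + closer G v u                         ∎
    where
    open ≡-Reasoning
    balance : ∀ w → d w u + 𝟙 (does (d w u <? d w v)) ≡ d w v + 𝟙 (does (d w v <? d w u))
    balance w = m+[m<n]≡n+[n<m] (d w u) (d w v) (dist-adj w (adj-sym uv)) (dist-adj w uv)

  Balanced : Fin n → Fin n → Set
  Balanced a b = ∀ x y → adj x y ≡ true → x ≢ a → x ≢ b → transmission x ≡ transmission y

  balanced-swap : ∀ {a b} → Balanced a b → Balanced b a
  balanced-swap bal x y xy x≢b x≢a = bal x y xy x≢a x≢b

  transmission-on-side : ∀ {a b} → Balanced a b → ∀ m w → d a w ≡ m → d w a ≤ d w b →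
                         transmission w ≡ transmission a
  transmission-on-side bal zero w daw≡0 _ with dist≡0⇒≡ daw≡0
  ... | refl = refl
  transmission-on-side {a} {b} bal (suc m) w daw≡1+m w⊑a with dist-pred daw≡1+m
  ... | y , yw , day≡m =
    trans (bal w y (adj-sym yw) w≢a w≢b) (transmission-on-side bal m y day≡m y⊑a)
    where
    dwa≡1+m : d w a ≡ suc m
    dwa≡1+m = trans (dist-sym w a) daw≡1+m
    w≢a : w ≢ a
    w≢a refl with trans (sym daw≡1+m) (dist-self a)
    ... | ()
    w≢b : w ≢ b
    w≢b refl with subst₂ _≤_ dwa≡1+m (dist-self w) w⊑a
    ... | ()
    y⊑a : d y a ≤ d y b
    y⊑a = ≤-pred (begin
      suc (d y a)  ≡⟨ cong suc (trans (dist-sym y a) day≡m) ⟩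
      suc m        ≡⟨ dwa≡1+m ⟨
      d w a        ≤⟨ w⊑a ⟩
      d w b        ≡⟨ dist-sym w b ⟩
      d b w        ≤⟨ dist-adj b yw ⟩
      suc (d b y)  ≡⟨ cong suc (dist-sym b y) ⟩
      suc (d y b)  ∎)
      where open ≤-Reasoning

  self-closer : ∀ {u v} → adj u v ≡ true → d u u < d u v
  self-closer {u} {v} uv = subst (_< d u v) (sym (dist-self u)) (n≢0⇒n>0 (adj⇒≢ uv ∘ dist≡0⇒≡))

  module UnbalancedEdge {a b : Fin n} (ab : adj a b ≡ true) (bal : Balanced a b)
                        (σa≢σb : transmission a ≢ transmission b) where

    side-a : ∀ w → d w a ≤ d w b → transmission w ≡ transmission a
    side-a w = transmission-on-side bal _ w refl

    side-b : ∀ w → d w b ≤ d w a → transmission w ≡ transmission b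
    side-b w = transmission-on-side (balanced-swap bal) _ w refl

    no-tie : ∀ w → d w a ≢ d w b
    no-tie w e = σa≢σb (trans (sym (side-a w (≤-reflexive e))) (side-b w (≤-reflexive (sym e))))

    only-crossing : ∀ {x y} → d x a < d x b → d y b < d y a → adj x y ≡ true → x ≡ a
    only-crossing {x} {y} x⊏a y⊏b xy with x ≟ᶠ a
    ... | yes x≡a = x≡a
    ... | no  x≢a = ⊥-elim (σa≢σb (begin
          transmission a ≡⟨ side-a x (<⇒≤ x⊏a) ⟨
          transmission x ≡⟨ bal x y xy x≢a x≢b ⟩
          transmission y ≡⟨ side-b y (<⇒≤ y⊏b) ⟩
          transmission b ∎))
      where
      open ≡-Reasoning
      x≢b : x ≢ b
      x≢b refl = n≮0 (subst (d b a <_) (dist-self b) x⊏a)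

    through-a : ∀ m {x y} → d y x ≡ m → d x a < d x b → d y b < d y a → d y a + d a x ≤ d y x
    through-a m {x} {y} dyx≡m x⊏a y⊏b with x ≟ᶠ a
    ... | yes refl = ≤-reflexive (trans (cong (d y a +_) (dist-self a)) (+-identityʳ (d y a)))
    through-a zero {x} {y} dyx≡0 x⊏a y⊏b | no _ with dist≡0⇒≡ dyx≡0
    ... | refl = ⊥-elim (<-asym x⊏a y⊏b)
    through-a (suc m) {x} {y} dyx≡1+m x⊏a y⊏b | no x≢a with dist-pred dyx≡1+m
    ... | z , zx , dyz≡m with <-cmp (d z a) (d z b)
    ...   | tri≈ _ tie _ = ⊥-elim (no-tie z tie)
    ...   | tri> _ _ z⊏b = ⊥-elim (x≢a (only-crossing x⊏a z⊏b (adj-sym zx)))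
    ...   | tri< z⊏a _ _ = begin
      d y a + d a x        ≤⟨ +-monoʳ-≤ (d y a) (dist-adj a zx) ⟩
      d y a + suc (d a z)  ≡⟨ +-suc (d y a) (d a z) ⟩
      suc (d y a + d a z)  ≤⟨ s≤s (through-a m dyz≡m z⊏a y⊏b) ⟩
      suc (d y z)          ≡⟨ cong suc dyz≡m ⟩
      suc m                ≡⟨ dyx≡1+m ⟨
      d y x                ∎
      where open ≤-Reasoning

    W-a : ∀ w → Dec (d w a < d w b)
    W-a w = d w a <? d w b

    W-b : ∀ w → Dec (d w b < d w a)
    W-b w = d w b <? d w a

    -- Against a, the distance to x loses at most D = d(a,x) on a's side (triangle inequality),
    -- gains exactly D on b's side (through-a), and at a itself is D instead of 0.
    detour : ∀ {x} → d x a < d x b → ∀ w →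
             d w a + d a x * 𝟙 (does (W-b w)) + (d a x + d a x) * 𝟙 (does (w ≟ᶠ a))
             ≤ d w x + d a x * 𝟙 (does (W-a w))
    detour {x} x∈W-a w with w ≟ᶠ a
    ... | yes refl rewrite dec-true (W-a a) (self-closer ab)
                         | dec-false (W-b a) (subst (λ t → ¬ d a b < t) (sym (dist-self a)) n≮0)
                         | dist-self a = ≤-reflexive (at-a (d a x))
      where
      at-a : ∀ D → 0 + D * 0 + (D + D) * 1 ≡ D + D * 1
      at-a = solve-∀
    ... | no w≢a with <-cmp (d w a) (d w b)
    ...   | tri≈ _ tie _ = ⊥-elim (no-tie w tie)
    ...   | tri< w∈W-a _ _ rewrite dec-true (W-a w) w∈W-a | dec-false (W-b w) (<⇒≯ w∈W-a) =
      subst₂ _≤_ (sym (a-side (d w a) (d a x))) (cong (d w x +_) (trans (dist-sym x a) (sym (*-identityʳ (d a x)))))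
                 (dist-triangle w x a)
      where
      a-side : ∀ e D → e + D * 0 + (D + D) * 0 ≡ e
      a-side = solve-∀
    ...   | tri> _ _ w∈W-b rewrite dec-false (W-a w) (<⇒≯ w∈W-b) | dec-true (W-b w) w∈W-b =
      subst₂ _≤_ (sym (b-side (d w a) (d a x))) (sym (no-weight (d w x) (d a x)))
                 (through-a _ refl x∈W-a w∈W-b)
      where
      b-side : ∀ e D → e + D * 1 + (D + D) * 0 ≡ e + D
      b-side = solve-∀
      no-weight : ∀ e D → e + D * 0 ≡ e
      no-weight = solve-∀

    closer-gap : closer G a b ≢ suc (closer G b a)
    closer-gap gap = <⇒≱ (n≢0⇒n>0 (x≢a ∘ sym ∘ dist≡0⇒≡)) (+-cancelˡ-≤ (transmission a + D * suc nᵦ) D 0 summed)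
      where
      open ≤-Reasoning
      nₐ nᵦ : ℕ
      nₐ = count W-a
      nᵦ = count W-b
      nₐ≡1+nᵦ : nₐ ≡ suc nᵦ
      nₐ≡1+nᵦ = trans (sym (closer≡count a b)) (trans gap (cong suc (closer≡count b a)))
      far : Σ (Fin n) λ x → d x a < d x b × x ≢ a
      far = count-≥2⇒∃≢ W-a (subst (2 ≤_) (sym nₐ≡1+nᵦ) (s≤s (1≤count W-b b (self-closer (adj-sym ab))))) a
      x : Fin n
      x = proj₁ far
      x∈W-a : d x a < d x b
      x∈W-a = proj₁ (proj₂ far)
      x≢a : x ≢ a
      x≢a = proj₂ (proj₂ far)
      D : ℕ
      D = d a x
      regroup : ∀ s D c → s + D * suc c + D ≡ s + D * c + (D + D) * 1
      regroup = solve-∀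
      summed : transmission a + D * suc nᵦ + D ≤ transmission a + D * suc nᵦ + 0
      summed = begin
        transmission a + D * suc nᵦ + D                   ≡⟨ regroup (transmission a) D nᵦ ⟩
        transmission a + D * nᵦ + (D + D) * 1             ≡⟨ cong₂ (λ s c → s + (D + D) * c)
                                                               (∑-distrib-+-*ˡ (λ w → d w a) _ D) (count-≟ a) ⟨
        ∑[ w < n ] (d w a + D * 𝟙 (does (W-b w))) + (D + D) * count (_≟ᶠ a)
                                                          ≡⟨ ∑-distrib-+-*ˡ (λ w → d w a + D * 𝟙 (does (W-b w))) _ (D + D) ⟨
        ∑[ w < n ] (d w a + D * 𝟙 (does (W-b w)) + (D + D) * 𝟙 (does (w ≟ᶠ a)))
                                                          ≤⟨ ∑-mono-≤ (detour x∈W-a) ⟩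
        ∑[ w < n ] (d w x + D * 𝟙 (does (W-a w)))         ≡⟨ ∑-distrib-+-*ˡ (λ w → d w x) _ D ⟩
        transmission x + D * nₐ                           ≡⟨ cong₂ _+_ (side-a x (<⇒≤ x∈W-a)) (cong (D *_) nₐ≡1+nᵦ) ⟩
        transmission a + D * suc nᵦ                       ≡⟨ +-identityʳ _ ⟨
        transmission a + D * suc nᵦ + 0                   ∎

  transmission≡⇔closer≡ : ∀ {u v} → adj u v ≡ true →
                          transmission u ≡ transmission v ⇔ closer G u v ≡ closer G v u
  transmission≡⇔closer≡ {u} {v} uv = mk⇔
    (λ σu≡σv → +-cancelˡ-≡ (transmission u) _ _ (trans (transmission-closer uv) (cong (_+ closer G v u) (sym σu≡σv))))
    (λ closer≡ → +-cancelʳ-≡ (closer G u v) _ _ (trans (transmission-closer uv) (cong (transmission v +_) (sym closer≡))))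

  lone-unit-term-impossible : ∀ {a b} → edgeTerm G a b ≡ 1 →
                              (∀ x y → x ≢ a ⊎ y ≢ b → edgeTerm G x y ≡ 0) → ⊥
  lone-unit-term-impossible {a} {b} term-ab≡1 vanishes =
    [ UnbalancedEdge.closer-gap ab bal σa≢σb
    , UnbalancedEdge.closer-gap (adj-sym ab) (balanced-swap bal) (σa≢σb ∘ sym)
    ]′ (∣m-n∣≡1⇒m≡1+n⊎n≡1+m _ _ ∣nₐ-nᵦ∣≡1)
    where
    ab : adj a b ≡ true
    ab = edgeTerm≢0⇒adj (λ term≡0 → 0≢1+n (trans (sym term≡0) term-ab≡1))
    ∣nₐ-nᵦ∣≡1 : ∣ closer G a b - closer G b a ∣ ≡ 1
    ∣nₐ-nᵦ∣≡1 = trans (sym (edgeTerm-both ab)) (cong₂ _+_ term-ab≡1 (vanishes b a (inj₁ (adj⇒≢ (adj-sym ab)))))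
    σa≢σb : transmission a ≢ transmission b
    σa≢σb σa≡σb with trans (sym ∣nₐ-nᵦ∣≡1) (m≡n⇒∣m-n∣≡0 (Equivalence.to (transmission≡⇔closer≡ ab) σa≡σb))
    ... | ()
    bal : Balanced a b
    bal x y xy x≢a x≢b = Equivalence.from (transmission≡⇔closer≡ xy) (∣m-n∣≡0⇒m≡n
      (trans (sym (edgeTerm-both xy)) (cong₂ _+_ (vanishes x y (inj₁ x≢a)) (vanishes y x (inj₂ x≢b)))))

  Mo≢1 : Mo G ≢ 1
  Mo≢1 Mo≡1 with ∑∑≡1⇒unique (edgeTerm G) (trans (sym (Mo≡∑∑edgeTerm G)) Mo≡1)
  ... | _ , _ , term-ab≡1 , vanishes = lone-unit-term-impossible term-ab≡1 vanishes

record IsGraphDistance (G : SimpleGraph) (D : Fin (SimpleGraph.n G) → Fin (SimpleGraph.n G) → ℕ) : Set where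
  open SimpleGraph G using (n; adj)
  field
    D-self : ∀ w → D w w ≡ 0
    D≡0⇒≡  : ∀ w v → D w v ≡ 0 → w ≡ v
    D-adj  : ∀ w u v → adj u v ≡ true → D w v ≤ suc (D w u)
    D-pred : ∀ w v m → D w v ≡ suc m → Σ (Fin n) λ u → adj u v ≡ true × D w u ≡ m
    D<n    : ∀ w v → D w v < n

module GraphDistance {G : SimpleGraph} {D : Fin (SimpleGraph.n G) → Fin (SimpleGraph.n G) → ℕ}
                     (isDist : IsGraphDistance G D) where
  open SimpleGraph G using (n; adj)
  open IsGraphDistance isDist
  open Reachability G

  within⇒D≤ : ∀ j w v → Within j w v → D w v ≤ j
  within⇒D≤ zero w v wv with within-zero⁻ wv
  ... | refl = ≤-reflexive (D-self w)
  within⇒D≤ (suc j) w v wv with within-suc⁻ wv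
  ... | inj₁ wv′            = m≤n⇒m≤1+n (within⇒D≤ j w v wv′)
  ... | inj₂ (x , wx , xv) = ≤-trans (D-adj w x v xv) (s≤s (within⇒D≤ j w x wx))

  D≤⇒within : ∀ j w v → D w v ≤ j → Within j w v
  D≤⇒within zero w v D≤0 with D≡0⇒≡ w v (n≤0⇒n≡0 D≤0)
  ... | refl = within-refl w
  D≤⇒within (suc j) w v D≤1+j with m≤n⇒m<n∨m≡n D≤1+j
  ... | inj₁ (s≤s D≤j) = within-suc (D≤⇒within j w v D≤j)
  ... | inj₂ D≡1+j with D-pred w v j D≡1+j
  ...   | u , uv , D≡j = within-snoc (D≤⇒within j w u (≤-reflexive D≡j)) uv

  dist≡D : ∀ w v → dist G w v ≡ D w v
  dist≡D w v = ≤-antisym (dist-≤ (D≤⇒within _ w v ≤-refl))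
                         (within⇒D≤ _ w v (dist-within (D≤⇒within _ w v ≤-refl) (D<n w v)))

  connected : 1 ≤ n → Connected G
  connected 1≤n = record { nonempty = 1≤n ; walk = λ u v → within→walk (D≤⇒within _ u v ≤-refl) }

-- The blow-up of a base graph A on Fin k adds a clique on M = q + 1 new vertices, each joined to
-- every base vertex i with δ i ≡ 1. A certificate says that Dᵇ (between base vertices) and δ (from a
-- base vertex to any clique vertex) are its distances; as it does not involve q, it is decided by
-- evaluation once for all q.
module BlowUp {k : ℕ} (A : Fin k → Fin k → Bool) (Dᵇ : Fin k → Fin k → ℕ) (δ : Fin k → ℕ) where

  attached : Fin k → Bool
  attached i = δ i ≡ᵇ 1

  record Certificate : Set where
    field
      A-sym          : ∀ i j → A i j ≡ A j i
      A-irrefl       : ∀ i → A i i ≡ false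
      Dᵇ-self        : ∀ i → Dᵇ i i ≡ 0
      Dᵇ≡0⇒≡         : ∀ i j → Dᵇ i j ≡ 0 → i ≡ j
      Dᵇ-adj         : ∀ w u v → A u v ≡ true → Dᵇ w v ≤ suc (Dᵇ w u)
      δ-adj          : ∀ u v → A u v ≡ true → δ v ≤ suc (δ u)
      δ-via-attached : ∀ w u → δ u ≡ 1 → δ w ≤ suc (Dᵇ w u)
      Dᵇ-via-clique  : ∀ w v → δ v ≡ 1 → Dᵇ w v ≤ suc (δ w)
      Dᵇ-pred        : ∀ w v → Dᵇ w v ≡ 0 ⊎ (∃ λ u → A u v ≡ true × suc (Dᵇ w u) ≡ Dᵇ w v)
                                          ⊎ (δ v ≡ 1 × suc (δ w) ≡ Dᵇ w v)
      δ-pred-clique  : ∀ w → ∃ λ u → δ u ≡ 1 × suc (Dᵇ w u) ≡ δ w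
      δ-pred-base    : ∀ v → δ v ≡ 1 ⊎ (∃ λ u → A u v ≡ true × suc (δ u) ≡ δ v)
      Dᵇ≤k           : ∀ i j → Dᵇ i j ≤ k
      δ≤k            : ∀ i → δ i ≤ k
      1≤k            : 1 ≤ k

  certificate? : Dec Certificate
  certificate? = map′
    (λ (p₁ , p₂ , p₃ , p₄ , p₅ , p₆ , p₇ , p₈ , p₉ , p₁₀ , p₁₁ , p₁₂ , p₁₃ , p₁₄) →
       record { A-sym = p₁ ; A-irrefl = p₂ ; Dᵇ-self = p₃ ; Dᵇ≡0⇒≡ = p₄ ; Dᵇ-adj = p₅ ; δ-adj = p₆
              ; δ-via-attached = p₇ ; Dᵇ-via-clique = p₈ ; Dᵇ-pred = p₉ ; δ-pred-clique = p₁₀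
              ; δ-pred-base = p₁₁ ; Dᵇ≤k = p₁₂ ; δ≤k = p₁₃ ; 1≤k = p₁₄ })
    (λ c → let open Certificate c in
       A-sym , A-irrefl , Dᵇ-self , Dᵇ≡0⇒≡ , Dᵇ-adj , δ-adj , δ-via-attached , Dᵇ-via-clique
             , Dᵇ-pred , δ-pred-clique , δ-pred-base , Dᵇ≤k , δ≤k , 1≤k)
    (    (all? λ i → all? λ j → A i j ≟ᵇ A j i)
    ×-dec (all? λ i → A i i ≟ᵇ false)
    ×-dec (all? λ i → Dᵇ i i ≟ 0)
    ×-dec (all? λ i → all? λ j → Dᵇ i j ≟ 0 →-dec i ≟ᶠ j)
    ×-dec (all? λ w → all? λ u → all? λ v → A u v ≟ᵇ true →-dec Dᵇ w v ≤? suc (Dᵇ w u))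
    ×-dec (all? λ u → all? λ v → A u v ≟ᵇ true →-dec δ v ≤? suc (δ u))
    ×-dec (all? λ w → all? λ u → δ u ≟ 1 →-dec δ w ≤? suc (Dᵇ w u))
    ×-dec (all? λ w → all? λ v → δ v ≟ 1 →-dec Dᵇ w v ≤? suc (δ w))
    ×-dec (all? λ w → all? λ v → Dᵇ w v ≟ 0
                               ⊎-dec any? (λ u → A u v ≟ᵇ true ×-dec suc (Dᵇ w u) ≟ Dᵇ w v)
                               ⊎-dec (δ v ≟ 1 ×-dec suc (δ w) ≟ Dᵇ w v))
    ×-dec (all? λ w → any? λ u → δ u ≟ 1 ×-dec suc (Dᵇ w u) ≟ δ w)
    ×-dec (all? λ v → δ v ≟ 1 ⊎-dec any? λ u → A u v ≟ᵇ true ×-dec suc (δ u) ≟ δ v)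
    ×-dec (all? λ i → all? λ j → Dᵇ i j ≤? k)
    ×-dec (all? λ i → δ i ≤? k)
    ×-dec 1 ≤? k)

  module Graph (cert : Certificate) (q : ℕ) where
    open Certificate cert

    M : ℕ
    M = suc q

    Vertex : Set
    Vertex = Fin k ⊎ Fin M

    adjᵛ : Vertex → Vertex → Bool
    adjᵛ (inj₁ i) (inj₁ j) = A i j
    adjᵛ (inj₁ i) (inj₂ _) = attached i
    adjᵛ (inj₂ _) (inj₁ j) = attached j
    adjᵛ (inj₂ c) (inj₂ e) = not (does (c ≟ᶠ e))

    Dᵛ : Vertex → Vertex → ℕ
    Dᵛ (inj₁ i) (inj₁ j) = Dᵇ i j
    Dᵛ (inj₁ i) (inj₂ _) = δ i
    Dᵛ (inj₂ _) (inj₁ j) = δ j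
    Dᵛ (inj₂ c) (inj₂ e) = 𝟙 (not (does (c ≟ᶠ e)))

    δ-pos : ∀ i → 1 ≤ δ i
    δ-pos i with δ-pred-clique i
    ... | _ , _ , 1+D≡δ = subst (1 ≤_) 1+D≡δ (s≤s z≤n)

    attached⇒δ≡1 : ∀ {i} → attached i ≡ true → δ i ≡ 1
    attached⇒δ≡1 {i} att = ≡ᵇ⇒≡ (δ i) 1 (Equivalence.from T-≡ att)

    δ≡1⇒attached : ∀ {i} → δ i ≡ 1 → attached i ≡ true
    δ≡1⇒attached {i} δ≡1 = Equivalence.to T-≡ (≡⇒≡ᵇ (δ i) 1 δ≡1)

    adjᵛ-sym : ∀ x y → adjᵛ x y ≡ adjᵛ y x
    adjᵛ-sym (inj₁ i) (inj₁ j) = A-sym i j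
    adjᵛ-sym (inj₁ i) (inj₂ _) = refl
    adjᵛ-sym (inj₂ _) (inj₁ j) = refl
    adjᵛ-sym (inj₂ c) (inj₂ e) = cong not (does-⇔ (mk⇔ sym sym) (c ≟ᶠ e) (e ≟ᶠ c))

    Dᵛ-self : ∀ x → Dᵛ x x ≡ 0
    Dᵛ-self (inj₁ i) = Dᵇ-self i
    Dᵛ-self (inj₂ c) = cong (𝟙 ∘ not) (dec-true (c ≟ᶠ c) refl)

    adjᵛ-irrefl : ∀ x → adjᵛ x x ≡ false
    adjᵛ-irrefl (inj₁ i) = A-irrefl i
    adjᵛ-irrefl (inj₂ c) = cong not (dec-true (c ≟ᶠ c) refl)

    Dᵛ≡0⇒≡ : ∀ x y → Dᵛ x y ≡ 0 → x ≡ y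
    Dᵛ≡0⇒≡ (inj₁ i) (inj₁ j) D≡0 = cong inj₁ (Dᵇ≡0⇒≡ i j D≡0)
    Dᵛ≡0⇒≡ (inj₁ i) (inj₂ _) δ≡0 = ⊥-elim (<-irrefl (sym δ≡0) (δ-pos i))
    Dᵛ≡0⇒≡ (inj₂ _) (inj₁ j) δ≡0 = ⊥-elim (<-irrefl (sym δ≡0) (δ-pos j))
    Dᵛ≡0⇒≡ (inj₂ c) (inj₂ e) D≡0 with c ≟ᶠ e
    ... | yes refl = refl

    Dᵛ-adj : ∀ x y z → adjᵛ y z ≡ true → Dᵛ x z ≤ suc (Dᵛ x y)
    Dᵛ-adj (inj₁ w) (inj₁ u) (inj₁ v) uv  = Dᵇ-adj w u v uv
    Dᵛ-adj (inj₁ w) (inj₁ u) (inj₂ _) att = δ-via-attached w u (attached⇒δ≡1 att)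
    Dᵛ-adj (inj₁ w) (inj₂ _) (inj₁ v) att = Dᵇ-via-clique w v (attached⇒δ≡1 att)
    Dᵛ-adj (inj₁ w) (inj₂ _) (inj₂ _) _   = n≤1+n (δ w)
    Dᵛ-adj (inj₂ _) (inj₁ u) (inj₁ v) uv  = δ-adj u v uv
    Dᵛ-adj (inj₂ _) (inj₁ _) (inj₂ _) _   = ≤-trans (𝟙≤1 _) (s≤s z≤n)
    Dᵛ-adj (inj₂ _) (inj₂ _) (inj₁ v) att = ≤-trans (≤-reflexive (attached⇒δ≡1 att)) (s≤s z≤n)
    Dᵛ-adj (inj₂ _) (inj₂ _) (inj₂ _) _   = ≤-trans (𝟙≤1 _) (s≤s z≤n)

    Dᵛ-pred : ∀ x z m → Dᵛ x z ≡ suc m → Σ Vertex λ y → adjᵛ y z ≡ true × Dᵛ x y ≡ m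
    Dᵛ-pred (inj₁ w) (inj₁ v) m D≡1+m with Dᵇ-pred w v
    ... | inj₁ D≡0                          = ⊥-elim (0≢1+n (trans (sym D≡0) D≡1+m))
    ... | inj₂ (inj₁ (u , uv , 1+Dwu≡Dwv)) = inj₁ u , uv , suc-injective (trans 1+Dwu≡Dwv D≡1+m)
    ... | inj₂ (inj₂ (δv≡1 , 1+δw≡Dwv))    = inj₂ fzero , δ≡1⇒attached δv≡1 , suc-injective (trans 1+δw≡Dwv D≡1+m)
    Dᵛ-pred (inj₁ w) (inj₂ _) m δ≡1+m with δ-pred-clique w
    ... | u , δu≡1 , 1+Dwu≡δw = inj₁ u , δ≡1⇒attached δu≡1 , suc-injective (trans 1+Dwu≡δw δ≡1+m)
    Dᵛ-pred (inj₂ c) (inj₁ v) m δ≡1+m with δ-pred-base v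
    ... | inj₁ δv≡1 = inj₂ c , δ≡1⇒attached δv≡1 , trans (Dᵛ-self (inj₂ c)) (suc-injective (trans (sym δv≡1) δ≡1+m))
    ... | inj₂ (u , uv , 1+δu≡δv) = inj₁ u , uv , suc-injective (trans 1+δu≡δv δ≡1+m)
    Dᵛ-pred (inj₂ c) (inj₂ e) m D≡1+m with c ≟ᶠ e
    Dᵛ-pred (inj₂ c) (inj₂ e) zero D≡1 | no c≢e = inj₂ c , cong not (dec-false (c ≟ᶠ e) c≢e) , Dᵛ-self (inj₂ c)

    Dᵛ≤k : ∀ x y → Dᵛ x y ≤ k
    Dᵛ≤k (inj₁ i) (inj₁ j) = Dᵇ≤k i j
    Dᵛ≤k (inj₁ i) (inj₂ _) = δ≤k i
    Dᵛ≤k (inj₂ _) (inj₁ j) = δ≤k j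
    Dᵛ≤k (inj₂ _) (inj₂ _) = ≤-trans (𝟙≤1 _) 1≤k

    vertex : Fin (k + M) → Vertex
    vertex = splitAt k

    graph : SimpleGraph
    graph = record
      { n      = k + M
      ; adj    = λ u v → adjᵛ (vertex u) (vertex v)
      ; sym    = λ u v → adjᵛ-sym (vertex u) (vertex v)
      ; irrefl = λ u → adjᵛ-irrefl (vertex u)
      }

    D : Fin (k + M) → Fin (k + M) → ℕ
    D u v = Dᵛ (vertex u) (vertex v)

    vertex-injective : ∀ {u v} → vertex u ≡ vertex v → u ≡ v
    vertex-injective {u} {v} eq = trans (sym (join-splitAt k M u)) (trans (cong (join k M) eq) (join-splitAt k M v))

    isDistance : IsGraphDistance graph D
    isDistance = record
      { D-self = λ w → Dᵛ-self (vertex w)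
      ; D≡0⇒≡  = λ w v D≡0 → vertex-injective (Dᵛ≡0⇒≡ (vertex w) (vertex v) D≡0)
      ; D-adj  = λ w u v → Dᵛ-adj (vertex w) (vertex u) (vertex v)
      ; D-pred = predecessor
      ; D<n    = λ w v → ≤-<-trans (Dᵛ≤k (vertex w) (vertex v)) (m<m+n k z<s)
      }
      where
      predecessor : ∀ w v m → D w v ≡ suc m → Σ (Fin (k + M)) λ u → adjᵛ (vertex u) (vertex v) ≡ true × D w u ≡ m
      predecessor w v m D≡1+m with Dᵛ-pred (vertex w) (vertex v) m D≡1+m
      ... | y , yv , D≡m rewrite sym (splitAt-join k M y) = join k M y , yv , D≡m

    connected : Connected graph
    connected = GraphDistance.connected isDistance (≤-trans 1≤k (m≤m+n k M))

    open GraphDistance isDistance using (dist≡D)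

    closerᵛ : Vertex → Vertex → ℕ
    closerᵛ x y = count (λ w → Dᵛ (inj₁ w) x <? Dᵛ (inj₁ w) y) + count (λ c → Dᵛ (inj₂ c) x <? Dᵛ (inj₂ c) y)

    closer≡closerᵛ : ∀ u v → closer graph u v ≡ closerᵛ (vertex u) (vertex v)
    closer≡closerᵛ u v = begin
      closer graph u v
        ≡⟨ length-filter-tabulate (λ w → dist graph w u <? dist graph w v) id ⟩
      count (λ w → dist graph w u <? dist graph w v)
        ≡⟨ sum-cong-≗ (λ w → cong₂ (λ s t → 𝟙 (does (s <? t))) (dist≡D w u) (dist≡D w v)) ⟩
      count (λ w → D w u <? D w v)
        ≡⟨ ∑-splitAt k M (λ w → 𝟙 (does (D w u <? D w v))) ⟩
      ∑[ i < k ] 𝟙 (does (D (i ↑ˡ M) u <? D (i ↑ˡ M) v)) + ∑[ c < M ] 𝟙 (does (D (k ↑ʳ c) u <? D (k ↑ʳ c) v))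
        ≡⟨ cong₂ _+_ (sum-cong-≗ λ i → cong (λ x → 𝟙 (does (Dᵛ x (vertex u) <? Dᵛ x (vertex v)))) (splitAt-↑ˡ k i M))
                     (sum-cong-≗ λ c → cong (λ x → 𝟙 (does (Dᵛ x (vertex u) <? Dᵛ x (vertex v)))) (splitAt-↑ʳ k M c)) ⟩
      closerᵛ (vertex u) (vertex v) ∎
      where open ≡-Reasoning

    edgeTerm≡ : ∀ u v → edgeTerm graph u v ≡
      (if adjᵛ (vertex u) (vertex v) ∧ (toℕ u <ᵇ toℕ v)
       then ∣ closerᵛ (vertex u) (vertex v) - closerᵛ (vertex v) (vertex u) ∣ else 0)
    edgeTerm≡ u v rewrite closer≡closerᵛ u v | closer≡closerᵛ v u = refl

    baseTerm : Fin k → Fin k → ℕ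
    baseTerm i j = if A i j ∧ (toℕ i <ᵇ toℕ j)
      then ∣ count (λ w → Dᵇ w i <? Dᵇ w j) + (if does (δ i <? δ j) then M else 0)
           - (count (λ w → Dᵇ w j <? Dᵇ w i) + (if does (δ j <? δ i) then M else 0)) ∣
      else 0

    attachTerm : Fin k → ℕ
    attachTerm i = if attached i then ∣ count (λ w → Dᵇ w i <? δ w) - (count (λ w → δ w <? Dᵇ w i) + 1) ∣ else 0

    closerᵛ-base-clique : ∀ i c → closerᵛ (inj₁ i) (inj₂ c) ≡ count (λ w → Dᵇ w i <? δ w)
    closerᵛ-base-clique i c = trans (cong (count (λ w → Dᵇ w i <? δ w) +_) none) (+-identityʳ _)
      where
      none : count (λ e → δ i <? 𝟙 (not (does (e ≟ᶠ c)))) ≡ 0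
      none = trans (sum-cong-≗ λ e → cong 𝟙 (dec-false (δ i <? 𝟙 (not (does (e ≟ᶠ c)))) (≤⇒≯ (≤-trans (𝟙≤1 _) (δ-pos i)))))
                   (sum-replicate-zero M)

    closerᵛ-clique-base : ∀ i c → δ i ≡ 1 → closerᵛ (inj₂ c) (inj₁ i) ≡ count (λ w → δ w <? Dᵇ w i) + 1
    closerᵛ-clique-base i c δi≡1 = cong (count (λ w → δ w <? Dᵇ w i) +_) (trans (sum-cong-≗ only-c) (count-≟ c))
      where
      only-c : ∀ e → 𝟙 (does (𝟙 (not (does (e ≟ᶠ c))) <? δ i)) ≡ 𝟙 (does (e ≟ᶠ c))
      only-c e rewrite δi≡1 with e ≟ᶠ c
      ... | yes _ = refl
      ... | no  _ = refl

    closerᵛ-clique-clique : ∀ c e → c ≢ e → closerᵛ (inj₂ c) (inj₂ e) ≡ 1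
    closerᵛ-clique-clique c e c≢e =
      cong₂ _+_ (trans (sum-cong-≗ λ w → cong 𝟙 (dec-false (δ w <? δ w) (<-irrefl refl))) (sum-replicate-zero k))
                (trans (sum-cong-≗ only-c) (count-≟ c))
      where
      only-c : ∀ x → 𝟙 (does (𝟙 (not (does (x ≟ᶠ c))) <? 𝟙 (not (does (x ≟ᶠ e))))) ≡ 𝟙 (does (x ≟ᶠ c))
      only-c x with x ≟ᶠ c | x ≟ᶠ e
      ... | yes refl | yes refl = ⊥-elim (c≢e refl)
      ... | yes _    | no  _    = refl
      ... | no  _    | yes _    = refl
      ... | no  _    | no  _    = refl

    edgeTerm-base-base : ∀ i j → edgeTerm graph (i ↑ˡ M) (j ↑ˡ M) ≡ baseTerm i j
    edgeTerm-base-base i j rewrite edgeTerm≡ (i ↑ˡ M) (j ↑ˡ M) | splitAt-↑ˡ k i M | splitAt-↑ˡ k j M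
                                 | toℕ-↑ˡ i M | toℕ-↑ˡ j M
                                 | ∑-𝟙-const M (does (δ i <? δ j)) | ∑-𝟙-const M (does (δ j <? δ i)) = refl

    edgeTerm-base-clique : ∀ i c → edgeTerm graph (i ↑ˡ M) (k ↑ʳ c) ≡ attachTerm i
    edgeTerm-base-clique i c
      rewrite edgeTerm≡ (i ↑ˡ M) (k ↑ʳ c) | splitAt-↑ˡ k i M | splitAt-↑ʳ k M c | toℕ-↑ˡ i M | toℕ-↑ʳ k c
            | dec-true (toℕ i <? k + toℕ c) (≤-trans (toℕ<n i) (m≤m+n k (toℕ c)))
      with attached i in att
    ... | false = refl
    ... | true rewrite closerᵛ-base-clique i c | closerᵛ-clique-base i c (attached⇒δ≡1 att) = refl

    edgeTerm-clique-base : ∀ c j → edgeTerm graph (k ↑ʳ c) (j ↑ˡ M) ≡ 0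
    edgeTerm-clique-base c j
      rewrite edgeTerm≡ (k ↑ʳ c) (j ↑ˡ M) | toℕ-↑ʳ k c | toℕ-↑ˡ j M
            | dec-false (k + toℕ c <? toℕ j) (≤⇒≯ (≤-trans (<⇒≤ (toℕ<n j)) (m≤m+n k (toℕ c))))
            | ∧-zeroʳ (adjᵛ (vertex (k ↑ʳ c)) (vertex (j ↑ˡ M))) = refl

    edgeTerm-clique-clique : ∀ c e → edgeTerm graph (k ↑ʳ c) (k ↑ʳ e) ≡ 0
    edgeTerm-clique-clique c e rewrite edgeTerm≡ (k ↑ʳ c) (k ↑ʳ e) | splitAt-↑ʳ k M c | splitAt-↑ʳ k M e
      with c ≟ᶠ e
    ... | yes _   = refl
    ... | no  c≢e rewrite closerᵛ-clique-clique c e c≢e | closerᵛ-clique-clique e c (c≢e ∘ sym) =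
      if-same (toℕ (k ↑ʳ c) <ᵇ toℕ (k ↑ʳ e))
      where
      if-same : ∀ b → (if b then 0 else 0) ≡ 0
      if-same true  = refl
      if-same false = refl

    Mo-graph : Mo graph ≡ ∑[ i < k ] ∑[ j < k ] baseTerm i j + M * ∑[ i < k ] attachTerm i
    Mo-graph = begin
      Mo graph
        ≡⟨ Mo≡∑∑edgeTerm graph ⟩
      ∑[ u < k + M ] row u
        ≡⟨ ∑-splitAt k M row ⟩
      ∑[ i < k ] row (i ↑ˡ M) + ∑[ c < M ] row (k ↑ʳ c)
        ≡⟨ cong₂ _+_ (sum-cong-≗ base-row) (trans (sum-cong-≗ clique-row) (sum-replicate-zero M)) ⟩
      ∑[ i < k ] (∑[ j < k ] baseTerm i j + M * attachTerm i) + 0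
        ≡⟨ +-identityʳ _ ⟩
      ∑[ i < k ] (∑[ j < k ] baseTerm i j + M * attachTerm i)
        ≡⟨ ∑-distrib-+-*ˡ (λ i → ∑[ j < k ] baseTerm i j) attachTerm M ⟩
      ∑[ i < k ] ∑[ j < k ] baseTerm i j + M * ∑[ i < k ] attachTerm i ∎
      where
      open ≡-Reasoning
      row : Fin (k + M) → ℕ
      row u = ∑[ v < k + M ] edgeTerm graph u v
      base-row : ∀ i → row (i ↑ˡ M) ≡ ∑[ j < k ] baseTerm i j + M * attachTerm i
      base-row i = trans (∑-splitAt k M (edgeTerm graph (i ↑ˡ M)))
                         (cong₂ _+_ (sum-cong-≗ (edgeTerm-base-base i))
                                    (trans (sum-cong-≗ (edgeTerm-base-clique i)) (∑-const M (attachTerm i))))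
      clique-row : ∀ c → row (k ↑ʳ c) ≡ 0
      clique-row c = trans (∑-splitAt k M (edgeTerm graph (k ↑ʳ c)))
                           (cong₂ _+_ (trans (sum-cong-≗ (edgeTerm-clique-base c)) (sum-replicate-zero k))
                                      (trans (sum-cong-≗ (edgeTerm-clique-clique c)) (sum-replicate-zero M)))

hasEdge : List (ℕ × ℕ) → ℕ → ℕ → Bool
hasEdge es a b = any (λ e → (proj₁ e ≡ᵇ a) ∧ (proj₂ e ≡ᵇ b)) es

edgeRelation : ∀ {k} → List (ℕ × ℕ) → Fin k → Fin k → Bool
edgeRelation es i j = hasEdge es (toℕ i) (toℕ j) ∨ hasEdge es (toℕ j) (toℕ i)

table : ∀ {k} → Vec (Vec ℕ k) k → Fin k → Fin k → ℕ
table t i j = lookup (lookup t i) j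

loopless? : ∀ n es → Dec (∀ i → edgeRelation {n} es i i ≡ false)
loopless? n es = all? λ i → edgeRelation es i i ≟ᵇ false

fromEdges : (n : ℕ) (es : List (ℕ × ℕ)) {loopless : True (loopless? n es)} → SimpleGraph
fromEdges n es {loopless} = record
  { n      = n
  ; adj    = edgeRelation es
  ; sym    = λ u v → ∨-comm (hasEdge es (toℕ u) (toℕ v)) _
  ; irrefl = toWitness loopless
  }

radius? : ∀ G r → Dec (∀ u v → T (within G r u v))
radius? G r = all? λ u → all? λ v → T? (within G r u v)

connected-radius : ∀ G r {nonempty : True (1 ≤? SimpleGraph.n G)} {near : True (radius? G r)} → Connected G
connected-radius G r {nonempty} {near} = record
  { nonempty = toWitness nonempty
  ; walk     = λ u v → Reachability.within→walk G {r} (Reachability.within✓ (toWitness near u v))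
  }

graph₀ graph₃ graph₅ : SimpleGraph
graph₀ = fromEdges 1 []
graph₃ = fromEdges 9 ((0 , 2) ∷ (0 , 7) ∷ (0 , 8) ∷ (1 , 3) ∷ (1 , 5) ∷ (1 , 8) ∷ (2 , 4) ∷ (2 , 6) ∷ (2 , 7)
                    ∷ (3 , 6) ∷ (3 , 8) ∷ (4 , 5) ∷ (4 , 6) ∷ (4 , 7) ∷ (5 , 7) ∷ [])
graph₅ = fromEdges 11 ((0 , 2) ∷ (0 , 4) ∷ (0 , 5) ∷ (0 , 10) ∷ (1 , 3) ∷ (1 , 4) ∷ (1 , 7) ∷ (1 , 10) ∷ (2 , 8)
                     ∷ (2 , 9) ∷ (2 , 10) ∷ (3 , 4) ∷ (3 , 5) ∷ (3 , 6) ∷ (3 , 7) ∷ (4 , 6) ∷ (5 , 9) ∷ (6 , 7)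
                     ∷ (6 , 9) ∷ (7 , 8) ∷ (8 , 9) ∷ (8 , 10) ∷ [])

edges₂ edges₄ : List (ℕ × ℕ)
edges₂ = (0 , 2) ∷ (0 , 3) ∷ (0 , 4) ∷ (1 , 2) ∷ (1 , 3) ∷ []
edges₄ = (0 , 2) ∷ (0 , 4) ∷ (0 , 5) ∷ (1 , 2) ∷ (1 , 3) ∷ (1 , 4) ∷ (2 , 3) ∷ []

A₁ : Fin 2 → Fin 2 → Bool
A₁ = edgeRelation ((0 , 1) ∷ [])
Dᵇ₁ : Fin 2 → Fin 2 → ℕ
Dᵇ₁ = table ((0 ∷ 1 ∷ []) ∷ (1 ∷ 0 ∷ []) ∷ [])
δ₁ : Fin 2 → ℕ
δ₁ = lookup (1 ∷ 2 ∷ [])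

A₂ : Fin 5 → Fin 5 → Bool
A₂ = edgeRelation edges₂
Dᵇ₂ : Fin 5 → Fin 5 → ℕ
Dᵇ₂ = table ((0 ∷ 2 ∷ 1 ∷ 1 ∷ 1 ∷ []) ∷ (2 ∷ 0 ∷ 1 ∷ 1 ∷ 3 ∷ []) ∷ (1 ∷ 1 ∷ 0 ∷ 2 ∷ 2 ∷ [])
           ∷ (1 ∷ 1 ∷ 2 ∷ 0 ∷ 2 ∷ []) ∷ (1 ∷ 3 ∷ 2 ∷ 2 ∷ 0 ∷ []) ∷ [])
δ₂ : Fin 5 → ℕ
δ₂ = lookup (1 ∷ 2 ∷ 1 ∷ 1 ∷ 2 ∷ [])

A₃ : Fin 5 → Fin 5 → Bool
A₃ = edgeRelation ((0 , 2) ∷ (0 , 4) ∷ (1 , 2) ∷ (1 , 3) ∷ [])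
Dᵇ₃ : Fin 5 → Fin 5 → ℕ
Dᵇ₃ = table ((0 ∷ 2 ∷ 1 ∷ 2 ∷ 1 ∷ []) ∷ (2 ∷ 0 ∷ 1 ∷ 1 ∷ 3 ∷ []) ∷ (1 ∷ 1 ∷ 0 ∷ 2 ∷ 2 ∷ [])
           ∷ (2 ∷ 1 ∷ 2 ∷ 0 ∷ 3 ∷ []) ∷ (1 ∷ 3 ∷ 2 ∷ 3 ∷ 0 ∷ []) ∷ [])
δ₃ : Fin 5 → ℕ
δ₃ = lookup (1 ∷ 1 ∷ 1 ∷ 1 ∷ 2 ∷ [])

A₄ : Fin 6 → Fin 6 → Bool
A₄ = edgeRelation edges₄
Dᵇ₄ : Fin 6 → Fin 6 → ℕ
Dᵇ₄ = table ((0 ∷ 2 ∷ 1 ∷ 2 ∷ 1 ∷ 1 ∷ []) ∷ (2 ∷ 0 ∷ 1 ∷ 1 ∷ 1 ∷ 3 ∷ []) ∷ (1 ∷ 1 ∷ 0 ∷ 1 ∷ 2 ∷ 2 ∷ [])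
           ∷ (2 ∷ 1 ∷ 1 ∷ 0 ∷ 2 ∷ 3 ∷ []) ∷ (1 ∷ 1 ∷ 2 ∷ 2 ∷ 0 ∷ 2 ∷ []) ∷ (1 ∷ 3 ∷ 2 ∷ 3 ∷ 2 ∷ 0 ∷ []) ∷ [])
δ₄ : Fin 6 → ℕ
δ₄ = lookup (1 ∷ 2 ∷ 1 ∷ 2 ∷ 2 ∷ 2 ∷ [])

module Family₁ = BlowUp.Graph A₁ Dᵇ₁ δ₁ (from-yes (BlowUp.certificate? A₁ Dᵇ₁ δ₁))
module Family₂ = BlowUp.Graph A₂ Dᵇ₂ δ₂ (from-yes (BlowUp.certificate? A₂ Dᵇ₂ δ₂))
module Family₃ = BlowUp.Graph A₃ Dᵇ₃ δ₃ (from-yes (BlowUp.certificate? A₃ Dᵇ₃ δ₃))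
module Family₄ = BlowUp.Graph A₄ Dᵇ₄ δ₄ (from-yes (BlowUp.certificate? A₄ Dᵇ₄ δ₄))

graph₇ graph₉ : SimpleGraph
graph₇ = fromEdges 5 edges₂
graph₉ = fromEdges 6 edges₄

Realizable : ℕ → Set
Realizable m = Σ SimpleGraph λ G → Connected G × Mo G ≡ m

realizable-≡ : ∀ {m n} → m ≡ n → Realizable n → Realizable m
realizable-≡ m≡n = subst Realizable (sym m≡n)

-- Each left-hand side below is the normal form of the right-hand side of Mo-graph for that seed.
family₁ : ∀ q → Realizable (2 * q + 2)
family₁ q = Family₁.graph q , Family₁.connected q , trans (Family₁.Mo-graph q) (evaluated q)
  where
  evaluated : ∀ q → suc (q + 0 + 0 + suc (q * 1)) ≡ 2 * q + 2
  evaluated = solve-∀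

family₂ : ∀ q → Realizable (4 * q + 11)
family₂ q = Family₂.graph q , Family₂.connected q , trans (Family₂.Mo-graph q) (evaluated q)
  where
  evaluated : ∀ q → suc (suc (suc (suc (suc (suc (q + 0 + suc (suc (q + suc (suc (q + 0)) + 0)) + suc (q * 1)))))))
                    ≡ 4 * q + 11
  evaluated = solve-∀

family₃ : ∀ q → Realizable (8 * q + 13)
family₃ q = Family₃.graph q , Family₃.connected q , trans (Family₃.Mo-graph q) (evaluated q)
  where
  evaluated : ∀ q → suc (suc (suc (suc (q + 0 + 2 + suc (suc (suc (suc (suc (suc (suc (q * 7)))))))))))
                    ≡ 8 * q + 13
  evaluated = solve-∀

family₄ : ∀ q → Realizable (8 * q + 17)
family₄ q = Family₄.graph q , Family₄.connected q , trans (Family₄.Mo-graph q) (evaluated q)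
  where
  evaluated : ∀ q → suc (suc (q + suc (suc (suc (suc (suc (q + 0))))) + suc (suc (q + 1 + suc (suc (suc (q + 0 + 0)))))
                              + suc (suc (suc (suc (q * 4))))))
                    ≡ 8 * q + 17
  evaluated = solve-∀

sporadic₀ : Realizable 0
sporadic₀ = graph₀ , connected-radius graph₀ 0 , refl

sporadic₃ : Realizable 3
sporadic₃ = graph₃ , connected-radius graph₃ 3 , refl

sporadic₅ : Realizable 5
sporadic₅ = graph₅ , connected-radius graph₅ 3 , refl

sporadic₇ : Realizable 7
sporadic₇ = graph₇ , connected-radius graph₇ 3 , refl

sporadic₉ : Realizable 9
sporadic₉ = graph₉ , connected-radius graph₉ 3 , refl

realizable-by-residue : ∀ r q → r < 8 → r + q * 8 ≢ 1 → Realizable (r + q * 8)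
realizable-by-residue 0 zero          _ _   = sporadic₀
realizable-by-residue 0 (suc q)       _ _   = realizable-≡ (shape q) (family₁ (4 * q + 3))
  where shape : ∀ q → 0 + suc q * 8 ≡ 2 * (4 * q + 3) + 2
        shape = solve-∀
realizable-by-residue 1 zero          _ ≢1  = ⊥-elim (≢1 refl)
realizable-by-residue 1 (suc zero)    _ _   = sporadic₉
realizable-by-residue 1 (suc (suc q)) _ _   = realizable-≡ (shape q) (family₄ q)
  where shape : ∀ q → 1 + suc (suc q) * 8 ≡ 8 * q + 17
        shape = solve-∀
realizable-by-residue 2 q             _ _   = realizable-≡ (shape q) (family₁ (4 * q))
  where shape : ∀ q → 2 + q * 8 ≡ 2 * (4 * q) + 2
        shape = solve-∀
realizable-by-residue 3 zero          _ _   = sporadic₃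
realizable-by-residue 3 (suc q)       _ _   = realizable-≡ (shape q) (family₂ (2 * q))
  where shape : ∀ q → 3 + suc q * 8 ≡ 4 * (2 * q) + 11
        shape = solve-∀
realizable-by-residue 4 q             _ _   = realizable-≡ (shape q) (family₁ (4 * q + 1))
  where shape : ∀ q → 4 + q * 8 ≡ 2 * (4 * q + 1) + 2
        shape = solve-∀
realizable-by-residue 5 zero          _ _   = sporadic₅
realizable-by-residue 5 (suc q)       _ _   = realizable-≡ (shape q) (family₃ q)
  where shape : ∀ q → 5 + suc q * 8 ≡ 8 * q + 13
        shape = solve-∀
realizable-by-residue 6 q             _ _   = realizable-≡ (shape q) (family₁ (4 * q + 2))
  where shape : ∀ q → 6 + q * 8 ≡ 2 * (4 * q + 2) + 2
        shape = solve-∀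
realizable-by-residue 7 zero          _ _   = sporadic₇
realizable-by-residue 7 (suc q)       _ _   = realizable-≡ (shape q) (family₂ (2 * q + 1))
  where shape : ∀ q → 7 + suc q * 8 ≡ 4 * (2 * q + 1) + 11
        shape = solve-∀
realizable-by-residue (suc (suc (suc (suc (suc (suc (suc (suc r)))))))) q (s≤s (s≤s (s≤s (s≤s (s≤s (s≤s (s≤s (s≤s ())))))))) _

realizable : ∀ m → m ≢ 1 → Realizable m
realizable m m≢1 =
  realizable-≡ m≡r+q*8 (realizable-by-residue (m % 8) (m / 8) (m%n<n m 8) (m≢1 ∘ trans m≡r+q*8))
  where
  m≡r+q*8 : m ≡ m % 8 + m / 8 * 8
  m≡r+q*8 = m≡m%n+[m/n]*n m 8

mainTheorem1 : (m : ℕ) →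
    (Σ SimpleGraph (λ G → Connected G × Mo G ≡ m)) ⇔ (m ≢ 1)
mainTheorem1 m = mk⇔ (λ (G , conn , Mo≡m) m≡1 → Transmission.Mo≢1 G conn (trans Mo≡m m≡1)) (realizable m)
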